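{- Let $P_n$ be the path on $n\ge 2$ vertices. Then $\iota(\mathrm{Mid}(P_n))=\lfloor \frac{n+1}{3}\rfloor$.
   Context: For a graph $H$ and $S\subseteq V(H)$, let $N_H[S]$ be $S$ together with all vertices adjacent to a vertex of $S$. A set $S\subseteq V(H)$ is an isolating set of $H$ if $V(H)\setminus N_H[S]$ is an independent set of $H$; $\iota(H)$ is the minimum size of an isolating set of $H$. The middle graph $\mathrm{Mid}(G)$ has vertex set $V(G)\cup\{m_e: e\in E(G)\}$, with $v\sim m_e$ iff $v$ is an endpoint of $e$, $m_e\sim m_f$ iff distinct edges $e,f$ share an endpoint, and no edges between vertices of $V(G)$. -}

module Defs where

open import Data.Nat using (ℕ; suc; _≤_)
open import Data.Fin using (Fin; inject₁) renaming (suc to fsuc)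
open import Data.Sum using (_⊎_; inj₁; inj₂)
open import Data.Product using (Σ; ∃; _×_; _,_)
open import Data.Empty using (⊥)
open import Data.List using (List; length)
open import Data.List.Membership.Propositional using (_∈_)
open import Data.List.Relation.Unary.Any using (Any)
open import Data.List.Relation.Unary.Unique.Propositional using (Unique)
open import Relation.Nullary using (¬_)
open import Relation.Binary.PropositionalEquality using (_≡_; _≢_)

record Graph : Set₁ where
  field
    V   : Set
    Adj : V → V → Set
open Graph public

InClosedNbhd : (H : Graph) → List (V H) → V H → Set
InClosedNbhd H S x = x ∈ S ⊎ Any (λ s → Adj H s x) S

IsIsolating : (H : Graph) → List (V H) → Set
IsIsolating H S = ∀ x y → ¬ InClosedNbhd H S x → ¬ InClosedNbhd H S y → ¬ Adj H x y

IsolationNumber : (H : Graph) → ℕ → Set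
IsolationNumber H k =
  (Σ (List (V H)) λ S → Unique S × IsIsolating H S × length S ≡ k)
  × (∀ S → IsIsolating H S → k ≤ length S)

record EdgeGraph : Set₁ where
  field
    Vert : Set
    Edge : Set
    end₁ : Edge → Vert
    end₂ : Edge → Vert
open EdgeGraph public

Incident : (G : EdgeGraph) → Vert G → Edge G → Set
Incident G v e = v ≡ end₁ G e ⊎ v ≡ end₂ G e

MidAdj : (G : EdgeGraph) → Vert G ⊎ Edge G → Vert G ⊎ Edge G → Set
MidAdj G (inj₁ u) (inj₁ v) = ⊥
MidAdj G (inj₁ v) (inj₂ e) = Incident G v e
MidAdj G (inj₂ e) (inj₁ v) = Incident G v e
MidAdj G (inj₂ e) (inj₂ f) = e ≢ f × ∃ λ v → Incident G v e × Incident G v f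

Mid : EdgeGraph → Graph
Mid G = record { V = Vert G ⊎ Edge G ; Adj = MidAdj G }

-- The path P_(m+1): vertices 0..m, edge i joins i and i+1 (i < m).
Path : ℕ → EdgeGraph
Path (suc m) = record { Vert = Fin (suc m) ; Edge = Fin m ; end₁ = inject₁ ; end₂ = fsuc }
Path 0 = record { Vert = Fin 0 ; Edge = Fin 0 ; end₁ = λ () ; end₂ = λ () }

-- Number the vertices of the path 0, …, m and its edges 0, …, m − 1 (edge i joins i and i + 1).
-- The edge-vertices 1, 4, 7, … of Mid(P) dominate every edge-vertex, so only original
-- vertices remain outside their closed neighbourhood, and those are pairwise non-adjacent.
-- Conversely, the closed neighbourhoods of the adjacent pairs (vertex 3j, edge 3j) are
-- pairwise disjoint, and an isolating set must meet each of them.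
module Submission where

open import Defs
open import Data.Nat using (ℕ; suc; _≤_; _<_; _+_; _*_; _/_; z≤n; s≤s; s≤s⁻¹; _≟_)
open import Data.Nat.Properties using (+-comm; ≮⇒≥; <-irrefl; *-monoˡ-≤; ≤-trans; ≤-reflexive; suc-injective)
open import Data.Nat.Divisibility using (divides-refl)
open import Data.Nat.DivMod using (+-distrib-/-∣ʳ; m<n⇒m/n≡0; m*n/n≡m; m/n*n≤m; m/n≡1+[m∸n]/n)
open import Data.Fin using (Fin; toℕ; inject₁; fromℕ<) renaming (zero to fzero; suc to fsuc)
open import Data.Fin.Properties using (toℕ-inject₁; toℕ-injective; toℕ-fromℕ<; pigeonhole)
import Data.Fin.Properties as Fin
open import Data.Sum using (_⊎_; inj₁; inj₂)
open import Data.Sum.Properties using (inj₂-injective)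
open import Data.Product using (Σ; ∃₂; _×_; _,_)
open import Data.Empty using (⊥-elim)
open import Function using (_∘_)
open import Data.List using (List; []; _∷_; length; map; lookup)
open import Data.List.Properties using (length-map)
open import Data.List.Membership.Propositional using (_∈_)
open import Data.List.Membership.Propositional.Properties using (∈-map⁺)
open import Data.List.Membership.DecPropositional _≟_ using (_∈?_)
open import Data.List.Relation.Unary.Any using (Any; here; there; index)
import Data.List.Relation.Unary.Any as Any
import Data.List.Relation.Unary.Any.Properties as Any
open import Data.List.Relation.Unary.All using ([]; universal)
import Data.List.Relation.Unary.All.Properties as All
open import Data.List.Relation.Unary.AllPairs using ([]; _∷_)
open import Data.List.Relation.Unary.Unique.Propositional using (Unique)
import Data.List.Relation.Unary.Unique.Propositional.Properties as Unique
open import Relation.Nullary using (¬_; yes; no)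
open import Relation.Binary.PropositionalEquality using (_≡_; refl; sym; trans; cong; subst)
open Relation.Binary.PropositionalEquality.≡-Reasoning

range⊆⇒≤length : ∀ k (xs : List ℕ) → (∀ j → j < k → j ∈ xs) → k ≤ length xs
range⊆⇒≤length k xs range⊆ = ≮⇒≥ (λ length<k → injective-position (pigeonhole length<k position))
  where
  position : Fin k → Fin (length xs)
  position i = index (range⊆ (toℕ i) (Fin.toℕ<n i))

  injective-position : ¬ ∃₂ λ i j → toℕ i < toℕ j × position i ≡ position j
  injective-position (i , j , i<j , same) = <-irrefl value-eq i<j
    where
    value-eq : toℕ i ≡ toℕ j
    value-eq = begin
      toℕ i                    ≡⟨ Any.lookup-index (range⊆ (toℕ i) (Fin.toℕ<n i)) ⟩
      lookup xs (position i)   ≡⟨ cong (lookup xs) same ⟩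
      lookup xs (position j)   ≡⟨ Any.lookup-index (range⊆ (toℕ j) (Fin.toℕ<n j)) ⟨
      toℕ j                    ∎

[r+j*3]/3≡j : ∀ r j → r < 3 → (r + j * 3) / 3 ≡ j
[r+j*3]/3≡j r j r<3 = begin
  (r + j * 3) / 3     ≡⟨ +-distrib-/-∣ʳ r (divides-refl j) ⟩
  r / 3 + j * 3 / 3   ≡⟨ cong (_+ j * 3 / 3) (m<n⇒m/n≡0 r<3) ⟩
  j * 3 / 3           ≡⟨ m*n/n≡m j 3 ⟩
  j                   ∎

<[m+2]/3⇒j*3< : ∀ {j m} → j < (suc m + 1) / 3 → j * 3 < m
<[m+2]/3⇒j*3< {j} {m} j< = s≤s⁻¹ (s≤s⁻¹ (≤-trans (*-monoˡ-≤ 3 j<)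
  (≤-trans (m/n*n≤m (suc m + 1) 3) (≤-reflexive (cong suc (+-comm m 1))))))

Dominates : (H : Graph) → V H → V H → Set
Dominates H s x = s ≡ x ⊎ Adj H s x

dominator∈⇒inClosedNbhd : ∀ (H : Graph) {S x} → Any (λ s → Dominates H s x) S → InClosedNbhd H S x
dominator∈⇒inClosedNbhd H (here (inj₁ refl)) = inj₁ (here refl)
dominator∈⇒inClosedNbhd H (here (inj₂ adj)) = inj₂ (here adj)
dominator∈⇒inClosedNbhd H (there p) with dominator∈⇒inClosedNbhd H p
... | inj₁ x∈S = inj₁ (there x∈S)
... | inj₂ adj = inj₂ (there adj)

LabelledEdge : (H : Graph) → (V H → ℕ) → ℕ → Set
LabelledEdge H label j =
  Σ (V H) λ x → Σ (V H) λ y → Adj H x y × (∀ s → Dominates H s x ⊎ Dominates H s y → label s ≡ j)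

inClosedNbhd⇒label∈ : ∀ (H : Graph) (label : V H → ℕ) {j S x} →
  (∀ s → Dominates H s x → label s ≡ j) → InClosedNbhd H S x → j ∈ map label S
inClosedNbhd⇒label∈ H label {S = S} {x} fibre (inj₁ x∈S) = subst (_∈ map label S) (fibre x (inj₁ refl)) (∈-map⁺ label x∈S)
inClosedNbhd⇒label∈ H label fibre (inj₂ adj) = Any.map⁺ (Any.map (λ {s} a → sym (fibre s (inj₂ a))) adj)

isolating⇒label∈ : ∀ (H : Graph) (label : V H → ℕ) {j S} →
  IsIsolating H S → LabelledEdge H label j → j ∈ map label S
isolating⇒label∈ H label {j} {S} iso (x , y , xy , fibre) with j ∈? map label S
... | yes j∈ = j∈
... | no j∉ = ⊥-elim (iso x y (j∉ ∘ inClosedNbhd⇒label∈ H label (λ s → fibre s ∘ inj₁))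
                             (j∉ ∘ inClosedNbhd⇒label∈ H label (λ s → fibre s ∘ inj₂)) xy)

-- Edges labelled by distinct j have disjoint closed neighbourhoods, and S meets each of them.
isolating⇒≤length : ∀ (H : Graph) (label : V H → ℕ) k →
  (∀ j → j < k → LabelledEdge H label j) → ∀ S → IsIsolating H S → k ≤ length S
isolating⇒≤length H label k edges S iso =
  ≤-trans (range⊆⇒≤length k (map label S) (λ j j<k → isolating⇒label∈ H label iso (edges j j<k)))
          (≤-reflexive (length-map label S))

edgesDominated⇒isolating : ∀ (G : EdgeGraph) (S : List (Vert G ⊎ Edge G)) →
  (∀ e → InClosedNbhd (Mid G) S (inj₂ e)) → IsIsolating (Mid G) S
edgesDominated⇒isolating G S dom (inj₂ e) y ¬x∈N ¬y∈N xy = ¬x∈N (dom e)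
edgesDominated⇒isolating G S dom (inj₁ u) (inj₂ e) ¬x∈N ¬y∈N xy = ¬y∈N (dom e)
edgesDominated⇒isolating G S dom (inj₁ u) (inj₁ v) ¬x∈N ¬y∈N ()

MidPath : ℕ → Graph
MidPath m = Mid (Path (suc m))

incident⇒toℕ : ∀ {m} {v : Fin (suc m)} {e : Fin m} →
  Incident (Path (suc m)) v e → toℕ v ≡ toℕ e ⊎ toℕ v ≡ suc (toℕ e)
incident⇒toℕ {e = e} (inj₁ refl) = inj₁ (toℕ-inject₁ e)
incident⇒toℕ (inj₂ refl) = inj₂ refl

edgeAdj⇒toℕ : ∀ {m} {e f : Fin m} →
  Adj (MidPath m) (inj₂ e) (inj₂ f) → suc (toℕ e) ≡ toℕ f ⊎ suc (toℕ f) ≡ toℕ e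
edgeAdj⇒toℕ (e≢f , v , ve , vf) with incident⇒toℕ ve | incident⇒toℕ vf
... | inj₁ p | inj₁ q = ⊥-elim (e≢f (toℕ-injective (trans (sym p) q)))
... | inj₁ p | inj₂ q = inj₂ (trans (sym q) p)
... | inj₂ p | inj₁ q = inj₁ (trans (sym p) q)
... | inj₂ p | inj₂ q = ⊥-elim (e≢f (toℕ-injective (suc-injective (trans (sym p) q))))

-- Block j consists of the vertices 3j, 3j+1, 3j+2 and the edges 3j−1, 3j, 3j+1.
block : ∀ {m} → V (MidPath m) → ℕ
block (inj₁ v) = toℕ v / 3
block (inj₂ e) = suc (toℕ e) / 3

inBlock : ∀ {j n} r → r < 3 → n ≡ r + j * 3 → n / 3 ≡ j
inBlock {j} r r<3 refl = [r+j*3]/3≡j r j r<3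

vertex-block : ∀ {m j} (e : Fin m) → toℕ e ≡ j * 3 →
  ∀ s → Dominates (MidPath m) s (inj₁ (inject₁ e)) → block s ≡ j
vertex-block e e≡ _ (inj₁ refl) = inBlock 0 (s≤s z≤n) (trans (toℕ-inject₁ e) e≡)
vertex-block e e≡ (inj₂ f) (inj₂ fe) with incident⇒toℕ fe
... | inj₁ p = inBlock 1 (s≤s (s≤s z≤n)) (cong suc (trans (sym p) (trans (toℕ-inject₁ e) e≡)))
... | inj₂ p = inBlock 0 (s≤s z≤n) (trans (sym p) (trans (toℕ-inject₁ e) e≡))

edge-block : ∀ {m j} (e : Fin m) → toℕ e ≡ j * 3 →
  ∀ s → Dominates (MidPath m) s (inj₂ e) → block s ≡ j
edge-block e e≡ _ (inj₁ refl) = inBlock 1 (s≤s (s≤s z≤n)) (cong suc e≡)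
edge-block e e≡ (inj₁ v) (inj₂ ve) with incident⇒toℕ ve
... | inj₁ p = inBlock 0 (s≤s z≤n) (trans p e≡)
... | inj₂ p = inBlock 1 (s≤s (s≤s z≤n)) (trans p (cong suc e≡))
edge-block e e≡ (inj₂ f) (inj₂ fe) with edgeAdj⇒toℕ fe
... | inj₁ p = inBlock 0 (s≤s z≤n) (trans p e≡)
... | inj₂ p = inBlock 2 (s≤s (s≤s (s≤s z≤n))) (cong suc (trans (sym p) (cong suc e≡)))

labelledEdge : ∀ {m} j → j * 3 < m → LabelledEdge (MidPath m) block j
labelledEdge j j*3<m = inj₁ (inject₁ e) , inj₂ e , inj₁ refl , fibre
  where
  e = fromℕ< j*3<m
  fibre : ∀ s → Dominates (MidPath _) s (inj₁ (inject₁ e)) ⊎ Dominates (MidPath _) s (inj₂ e) → block s ≡ j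
  fibre s (inj₁ d) = vertex-block e (toℕ-fromℕ< j*3<m) s d
  fibre s (inj₂ d) = edge-block e (toℕ-fromℕ< j*3<m) s d

isolating⇒[m+2]/3≤length : ∀ m S → IsIsolating (MidPath m) S → (suc m + 1) / 3 ≤ length S
isolating⇒[m+2]/3≤length m = isolating⇒≤length (MidPath m) block _ (λ j j< → labelledEdge j (<[m+2]/3⇒j*3< j<))

shift3 : ∀ {k} → Fin k → Fin (3 + k)
shift3 = fsuc ∘ fsuc ∘ fsuc

shift3-injective : ∀ {k} {x y : Fin k} → shift3 x ≡ shift3 y → x ≡ y
shift3-injective refl = refl

-- The edges 1, 4, 7, …, except that the single edge of P₂ is edge 0.
spacedEdges : (m : ℕ) → List (Fin m)
spacedEdges 0 = []
spacedEdges 1 = fzero ∷ []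
spacedEdges 2 = fsuc fzero ∷ []
spacedEdges (suc (suc (suc m))) = fsuc fzero ∷ map shift3 (spacedEdges m)

spacedEdges-unique : ∀ m → Unique (spacedEdges m)
spacedEdges-unique 0 = []
spacedEdges-unique 1 = [] ∷ []
spacedEdges-unique 2 = [] ∷ []
spacedEdges-unique (suc (suc (suc m))) =
  All.map⁺ (universal (λ _ ()) (spacedEdges m)) ∷ Unique.map⁺ shift3-injective (spacedEdges-unique m)

length-spacedEdges : ∀ m → length (spacedEdges m) ≡ (suc m + 1) / 3
length-spacedEdges 0 = refl
length-spacedEdges 1 = refl
length-spacedEdges 2 = refl
length-spacedEdges (suc (suc (suc m))) = begin
  suc (length (map shift3 (spacedEdges m)))   ≡⟨ cong suc (trans (length-map shift3 (spacedEdges m)) (length-spacedEdges m)) ⟩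
  suc ((suc m + 1) / 3)                        ≡⟨ m/n≡1+[m∸n]/n {suc (suc (suc (suc m + 1)))} (s≤s (s≤s (s≤s z≤n))) ⟨
  (suc (suc (suc (suc m))) + 1) / 3            ∎

shift3-dominates : ∀ {m} {c e : Fin m} →
  Dominates (MidPath m) (inj₂ c) (inj₂ e) → Dominates (MidPath (3 + m)) (inj₂ (shift3 c)) (inj₂ (shift3 e))
shift3-dominates (inj₁ refl) = inj₁ refl
shift3-dominates (inj₂ (c≢e , v , vc , ve)) = inj₂ (c≢e ∘ shift3-injective , shift3 v , shift vc , shift ve)
  where
  shift : ∀ {m} {v : Fin (suc m)} {c : Fin m} →
    Incident (Path (suc m)) v c → Incident (Path (4 + m)) (shift3 v) (shift3 c)
  shift (inj₁ refl) = inj₁ refl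
  shift (inj₂ refl) = inj₂ refl

1-dominates-0 : ∀ {m} → Dominates (MidPath (2 + m)) (inj₂ (fsuc fzero)) (inj₂ fzero)
1-dominates-0 = inj₂ ((λ ()) , fsuc fzero , inj₁ refl , inj₂ refl)

1-dominates-2 : ∀ {m} → Dominates (MidPath (3 + m)) (inj₂ (fsuc fzero)) (inj₂ (fsuc (fsuc fzero)))
1-dominates-2 = inj₂ ((λ ()) , fsuc (fsuc fzero) , inj₂ refl , inj₁ refl)

spacedEdges-dominate : ∀ m (e : Fin m) → Any (λ c → Dominates (MidPath m) (inj₂ c) (inj₂ e)) (spacedEdges m)
spacedEdges-dominate 1 fzero = here (inj₁ refl)
spacedEdges-dominate 2 fzero = here 1-dominates-0
spacedEdges-dominate 2 (fsuc fzero) = here (inj₁ refl)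
spacedEdges-dominate (suc (suc (suc m))) fzero = here 1-dominates-0
spacedEdges-dominate (suc (suc (suc m))) (fsuc fzero) = here (inj₁ refl)
spacedEdges-dominate (suc (suc (suc m))) (fsuc (fsuc fzero)) = here 1-dominates-2
spacedEdges-dominate (suc (suc (suc m))) (fsuc (fsuc (fsuc e))) =
  there (Any.map⁺ (Any.map shift3-dominates (spacedEdges-dominate m e)))

spacedEdges-isolating : ∀ m → IsIsolating (MidPath m) (map inj₂ (spacedEdges m))
spacedEdges-isolating m = edgesDominated⇒isolating (Path (suc m)) _
  (λ e → dominator∈⇒inClosedNbhd (MidPath m) (Any.map⁺ (spacedEdges-dominate m e)))

theorem4 : ∀ (n : ℕ) → 2 ≤ n → IsolationNumber (Mid (Path n)) ((n + 1) / 3)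
theorem4 (suc m) _ =
  ( map inj₂ (spacedEdges m)
  , Unique.map⁺ inj₂-injective (spacedEdges-unique m)
  , spacedEdges-isolating m
  , trans (length-map inj₂ (spacedEdges m)) (length-spacedEdges m) )
  , isolating⇒[m+2]/3≤length m
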